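{- Let $X$ and $Z$ be disjoint finite sets, $Q$ a partial order relation on $Z$, $y$ a point not in $X \cup Z$, $A_y = \{(y,y)\}$, and $W = X \cup Z$. Then for every $R \in \mathfrak{M}^*_{Q + A_y}(X, Z \cup \{y\})$, the relation $R|_W$ lies in $\mathfrak{U}(W \cap \downarrow_R y,\ W \setminus \downarrow_R y)$, and the mapping $$\sigma : \mathfrak{M}^*_{Q + A_y}(X, Z \cup \{y\}) \to \mathfrak{C}_{Q^d}(X, Z),\qquad R \mapsto \tau_{W \cap \downarrow_R y,\ W \setminus \downarrow_R y}(R|_W)$$ is well defined and bijective.
   Context: A partial order relation (p.o.r.) on a set $S$ is a reflexive, antisymmetric, transitive subset of $S \times S$; $\mathfrak{P}(S)$ denotes the set of p.o.r.s on $S$. For $R \in \mathfrak{P}(S)$ and $M \subseteq S$: $R|_M = R \cap (M \times M)$; $R^d = \{(b,a) : (a,b) \in R\}$; $\downarrow_R M = \{x \in S : (x,m) \in R \text{ for some } m \in M\}$, $\downarrow_R x = \downarrow_R\{x\}$. $M$ is an upper end of $R$ if $(m,x) \in R$, $m \in M$ imply $x \in M$; $M$ is convex in $R$ if $(a,x),(x,b) \in R$ with $a,b \in M$ imply $x \in M$. $\max R$ is the set of maximal points of $R$ ($x$ with $(x,z)\in R \Rightarrow z=x$). For p.o.r.s on disjoint carriers, $R_1 + R_2 = R_1 \cup R_2$. For disjoint finite sets $X', Y'$ and $Q' \in \mathfrak{P}(Y')$ define: $\mathfrak{U}(X',Y') = \{R \in \mathfrak{P}(X' \cup Y') : Y'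 \text{ is an upper end of } R\}$; $\mathfrak{C}_{Q'}(X',Y') = \{R \in \mathfrak{P}(X' \cup Y') : R|_{Y'} = Q' \text{ and } Y' \text{ is convex in } R\}$; $\mathfrak{M}^*_{Q'}(X',Y') = \{R \in \mathfrak{C}_{Q'}(X',Y') : \max Q' = \max R\}$. Finally, $\tau_{X',Y'} : \mathfrak{U}(X',Y') \to \mathfrak{U}(X',Y')$ is defined by $\tau_{X',Y'}(R) = (R|_{X'})^d \cup ((X' \times Y') \setminus R) \cup (R|_{Y'})^d$. -}

module Defs where

open import Data.Nat using (ℕ)
open import Data.Fin using (Fin)
open import Data.Bool using (Bool; true; false; _∧_; _∨_; not; T)
open import Data.Vec using (Vec; lookup; tabulate)
open import Data.Fin.Subset using (Subset; _∈_; _∉_; _∪_; _∩_; _─_; ⁅_⁆; Empty)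
open import Data.Product using (_×_; Σ; _,_)
open import Function.Bundles using (_⇔_)
open import Relation.Binary.PropositionalEquality using (_≡_)

-- A binary relation on (a subset of) Fin n, stored as a Boolean matrix,
-- so that propositional equality of relations is extensional.
Rel : ℕ → Set
Rel n = Vec (Vec Bool n) n

_⟪_,_⟫ : ∀ {n} → Rel n → Fin n → Fin n → Bool
R ⟪ a , b ⟫ = lookup (lookup R a) b

_∋⟨_,_⟩ : ∀ {n} → Rel n → Fin n → Fin n → Set
R ∋⟨ a , b ⟩ = T (R ⟪ a , b ⟫)

record IsPOR {n} (S : Subset n) (R : Rel n) : Set where
  field
    support : ∀ a b → R ∋⟨ a , b ⟩ → (a ∈ S) × (b ∈ S)
    refl    : ∀ a → a ∈ S → R ∋⟨ a , a ⟩
    antisym : ∀ a b → R ∋⟨ a , b ⟩ → R ∋⟨ b , a ⟩ → a ≡ b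
    trans   : ∀ a b c → R ∋⟨ a , b ⟩ → R ∋⟨ b , c ⟩ → R ∋⟨ a , c ⟩

restrict : ∀ {n} → Rel n → Subset n → Rel n
restrict R M = tabulate λ a → tabulate λ b → R ⟪ a , b ⟫ ∧ lookup M a ∧ lookup M b

dual : ∀ {n} → Rel n → Rel n
dual R = tabulate λ a → tabulate λ b → R ⟪ b , a ⟫

-- union of relations (used for R₁ + R₂ on disjoint carriers)
_∪R_ : ∀ {n} → Rel n → Rel n → Rel n
R₁ ∪R R₂ = tabulate λ a → tabulate λ b → R₁ ⟪ a , b ⟫ ∨ R₂ ⟪ a , b ⟫

diagPoint : ∀ {n} → Fin n → Rel n
diagPoint y = tabulate λ a → tabulate λ b → lookup ⁅ y ⁆ a ∧ lookup ⁅ y ⁆ b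

down : ∀ {n} → Rel n → Fin n → Subset n
down R x = tabulate λ z → R ⟪ z , x ⟫

UpperEnd : ∀ {n} → Rel n → Subset n → Set
UpperEnd R M = ∀ m x → R ∋⟨ m , x ⟩ → m ∈ M → x ∈ M

Convex : ∀ {n} → Rel n → Subset n → Set
Convex R M = ∀ a x b → R ∋⟨ a , x ⟩ → R ∋⟨ x , b ⟩ → a ∈ M → b ∈ M → x ∈ M

IsMax : ∀ {n} → Subset n → Rel n → Fin n → Set
IsMax S R x = (x ∈ S) × (∀ z → R ∋⟨ x , z ⟩ → z ≡ x)

𝔘 : ∀ {n} → Subset n → Subset n → Rel n → Set
𝔘 X' Y' R = IsPOR (X' ∪ Y') R × UpperEnd R Y'

ℭ : ∀ {n} → Rel n → Subset n → Subset n → Rel n → Set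
ℭ Q' X' Y' R = IsPOR (X' ∪ Y') R × (restrict R Y' ≡ Q') × Convex R Y'

-- 𝔐*_{Q'}(X', Y') : max Q' = max R (as sets; Q' has carrier Y', R has carrier X' ∪ Y')
𝔐* : ∀ {n} → Rel n → Subset n → Subset n → Rel n → Set
𝔐* Q' X' Y' R = ℭ Q' X' Y' R × (∀ x → IsMax Y' Q' x ⇔ IsMax (X' ∪ Y') R x)

τ : ∀ {n} → Subset n → Subset n → Rel n → Rel n
τ X' Y' R = tabulate λ a → tabulate λ b →
  (dual (restrict R X') ⟪ a , b ⟫)
  ∨ (lookup X' a ∧ lookup Y' b ∧ not (R ⟪ a , b ⟫))
  ∨ (dual (restrict R Y') ⟪ a , b ⟫)

σ : ∀ {n} → Subset n → Fin n → Rel n → Rel n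
σ W y R = τ (W ∩ down R y) (W ─ down R y) (restrict R W)

module Submission where

-- Write D = W ∩ ↓_R y and U = W ∖ ↓_R y. As max R = max (Q + A_y), the point y is maximal in R, so R
-- is R|_W with y adjoined on top of D, and R|_W ∈ 𝔘(D, U) because ↓_R y is a down-set. On 𝔘(D, U) the
-- map τ_{D,U} is an involution, so R is determined by σ R = τ_{D,U}(R|_W) once (D, U) is known. That
-- partition can be read off σ R: Z ⊆ U, and a point of U lies below a maximal point of R other than y,
-- hence below a point of Z, so U is the up-closure of Z in σ R. Conversely, for S ∈ ℭ_{Q^d}(X, Z) with
-- U′ the up-closure of Z in S and D′ = W ∖ U′, adjoining y above D′ to τ_{D′,U′}(S) gives the preimage
-- of S in 𝔐*.

open import Defs
open import Data.Nat using (ℕ)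
open import Data.Fin using (Fin; _≟_)
open import Data.Fin.Properties using (any?)
open import Data.Fin.Subset using (Subset; _∈_; _∉_; _∪_; _∩_; _─_; ⁅_⁆; Empty; _⊂_; _⊆_)
open import Data.Fin.Subset.Properties
  using (x∈p∪q⁻; x∈p∪q⁺; x∈p∩q⁻; x∈p∩q⁺; x∈⁅x⁆; x∈⁅y⁆⇒x≡y; x∈p∧x∉q⇒x∈p─q; p─q⊆p; ⊆-antisym; _∈?_;
         ∪-assoc; p⊆p∪q; q⊆p∪q)
open import Data.Fin.Subset.Induction using (⊂-wellFounded)
open import Induction.WellFounded using (Acc; acc)
open import Data.Bool using (Bool; true; false; _∧_; _∨_; not; T)
open import Data.Bool.Properties using (T-≡; T-∧; T-∨)
open import Data.Vec using ([]; _∷_; here; there; lookup; tabulate)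
open import Data.Vec.Properties
  using (lookup∘tabulate; tabulate∘lookup; tabulate-cong; []=⇒lookup; lookup⇒[]=)
open import Data.Product using (_×_; Σ; ∃; _,_; proj₁; proj₂)
open import Data.Sum using (_⊎_; inj₁; inj₂)
open import Data.Empty using (⊥; ⊥-elim)
open import Relation.Nullary using (¬_; yes; no)
open import Relation.Nullary.Decidable using (T?; ¬?; _×-dec_; isYes; toWitness; fromWitness)
open import Function.Bundles using (_⇔_; mk⇔; Equivalence)
open import Relation.Binary.PropositionalEquality
  using (_≡_; refl; sym; trans; cong; cong₂; subst; module ≡-Reasoning)

open Equivalence using (to; from)

private variable
  n : ℕ

-- Boolean matrices and subsets

∈⇔T : {S : Subset n} {a : Fin n} → a ∈ S ⇔ T (lookup S a)
∈⇔T {S = S} {a} = mk⇔ (λ p → from T-≡ ([]=⇒lookup p)) (λ t → lookup⇒[]= a S (to T-≡ t))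

∈-tabulate : (f : Fin n → Bool) {a : Fin n} → a ∈ tabulate f ⇔ T (f a)
∈-tabulate f {a} = mk⇔ (λ p → subst T (lookup∘tabulate f a) (to ∈⇔T p))
                      (λ t → from ∈⇔T (subst T (sym (lookup∘tabulate f a)) t))

∋-tabulate : (F : Fin n → Fin n → Bool) {a b : Fin n} →
             (tabulate λ a → tabulate (F a)) ∋⟨ a , b ⟩ ⇔ T (F a b)
∋-tabulate F {a} {b} = mk⇔ (subst T eq) (subst T (sym eq))
  where
  eq : (tabulate λ a → tabulate (F a)) ⟪ a , b ⟫ ≡ F a b
  eq = trans (cong (λ row → lookup row b) (lookup∘tabulate (λ a → tabulate (F a)) a))
             (lookup∘tabulate (F a) b)

T-not : {x : Bool} → T (not x) ⇔ (¬ T x)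
T-not {true}  = mk⇔ (λ ()) (λ ¬t → ¬t _)
T-not {false} = mk⇔ (λ _ ()) _

T-ext : {x y : Bool} → (T x ⇔ T y) → x ≡ y
T-ext {true}  {true}  _   = refl
T-ext {true}  {false} x⇔y = ⊥-elim (to x⇔y _)
T-ext {false} {true}  x⇔y = ⊥-elim (from x⇔y _)
T-ext {false} {false} _   = refl

Rel-ext : {R R′ : Rel n} → (∀ a b → R ∋⟨ a , b ⟩ ⇔ R′ ∋⟨ a , b ⟩) → R ≡ R′
Rel-ext {R = R} {R′} R⇔R′ = begin
  R                                          ≡⟨ tabulate∘lookup R ⟨
  tabulate (λ a → lookup R a)                ≡⟨ tabulate-cong row ⟩
  tabulate (λ a → lookup R′ a)               ≡⟨ tabulate∘lookup R′ ⟩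
  R′                                         ∎
  where
  open ≡-Reasoning
  row : ∀ a → lookup R a ≡ lookup R′ a
  row a = begin
    lookup R a                               ≡⟨ tabulate∘lookup (lookup R a) ⟨
    tabulate (λ b → R ⟪ a , b ⟫)             ≡⟨ tabulate-cong (λ b → T-ext (R⇔R′ a b)) ⟩
    tabulate (λ b → R′ ⟪ a , b ⟫)            ≡⟨ tabulate∘lookup (lookup R′ a) ⟩
    lookup R′ a                              ∎

x∈p─q⁻ : (p q : Subset n) {x : Fin n} → x ∈ p ─ q → x ∈ p × x ∉ q
x∈p─q⁻ p q x∈p─q = p─q⊆p p q x∈p─q , x∉q x∈p─q
  where
  x∉q : ∀ {p q : Subset n} {x} → x ∈ p ─ q → x ∉ q
  x∉q {p = true ∷ _} {false ∷ _} here         ()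
  x∉q {p = _ ∷ _}    {_ ∷ _}     (there x∈p─q) (there x∈q) = x∉q x∈p─q x∈q

x∈p∪⁅y⁆⁻ : (p : Subset n) {x y : Fin n} → x ∈ p ∪ ⁅ y ⁆ → x ∈ p ⊎ x ≡ y
x∈p∪⁅y⁆⁻ p {y = y} x∈ with x∈p∪q⁻ p ⁅ y ⁆ x∈
... | inj₁ x∈p = inj₁ x∈p
... | inj₂ x∈y = inj₂ (x∈⁅y⁆⇒x≡y y x∈y)

x∈p∪⁅y⁆⁺ : {p : Subset n} {x y : Fin n} → x ∈ p ⊎ x ≡ y → x ∈ p ∪ ⁅ y ⁆
x∈p∪⁅y⁆⁺         (inj₁ x∈p)  = x∈p∪q⁺ (inj₁ x∈p)
x∈p∪⁅y⁆⁺ {y = y} (inj₂ refl) = x∈p∪q⁺ (inj₂ (x∈⁅x⁆ y))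

p∩q∪p─q≡p : (p q : Subset n) → (p ∩ q) ∪ (p ─ q) ≡ p
p∩q∪p─q≡p []          []          = refl
p∩q∪p─q≡p (true  ∷ p) (true  ∷ q) = cong (true  ∷_) (p∩q∪p─q≡p p q)
p∩q∪p─q≡p (true  ∷ p) (false ∷ q) = cong (true  ∷_) (p∩q∪p─q≡p p q)
p∩q∪p─q≡p (false ∷ p) (true  ∷ q) = cong (false ∷_) (p∩q∪p─q≡p p q)
p∩q∪p─q≡p (false ∷ p) (false ∷ q) = cong (false ∷_) (p∩q∪p─q≡p p q)

p─[p─q]≡p∩q : (p q : Subset n) → p ─ (p ─ q) ≡ p ∩ q
p─[p─q]≡p∩q []          []          = refl
p─[p─q]≡p∩q (true  ∷ p) (true  ∷ q) = cong (true  ∷_) (p─[p─q]≡p∩q p q)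
p─[p─q]≡p∩q (true  ∷ p) (false ∷ q) = cong (false ∷_) (p─[p─q]≡p∩q p q)
p─[p─q]≡p∩q (false ∷ p) (true  ∷ q) = cong (false ∷_) (p─[p─q]≡p∩q p q)
p─[p─q]≡p∩q (false ∷ p) (false ∷ q) = cong (false ∷_) (p─[p─q]≡p∩q p q)

q⊆p⇒p─q∪q≡p : {p q : Subset n} → q ⊆ p → (p ─ q) ∪ q ≡ p
q⊆p⇒p─q∪q≡p {p = p} {q} q⊆p = ⊆-antisym ⊆p p⊆
  where
  ⊆p : (p ─ q) ∪ q ⊆ p
  ⊆p x∈ with x∈p∪q⁻ (p ─ q) q x∈
  ... | inj₁ x∈p─q = p─q⊆p p q x∈p─q
  ... | inj₂ x∈q   = q⊆p x∈q
  p⊆ : p ⊆ (p ─ q) ∪ q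
  p⊆ {x} x∈p with x ∈? q
  ... | yes x∈q = x∈p∪q⁺ (inj₂ x∈q)
  ... | no  x∉q = x∈p∪q⁺ (inj₁ (x∈p∧x∉q⇒x∈p─q x∈p x∉q))

p∩q∩[r─q]≡∅ : (p q r : Subset n) → Empty ((p ∩ q) ∩ (r ─ q))
p∩q∩[r─q]≡∅ p q r (x , x∈) =
  let (x∈p∩q , x∈r─q) = x∈p∩q⁻ (p ∩ q) (r ─ q) x∈
  in proj₂ (x∈p─q⁻ r q x∈r─q) (proj₂ (x∈p∩q⁻ p q x∈p∩q))

[p─q]∩q≡∅ : (p q : Subset n) → Empty ((p ─ q) ∩ q)
[p─q]∩q≡∅ p q (x , x∈) =
  let (x∈p─q , x∈q) = x∈p∩q⁻ (p ─ q) q x∈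
  in proj₂ (x∈p─q⁻ p q x∈p─q) x∈q

∋-restrict⁻ : (R : Rel n) (M : Subset n) {a b : Fin n} →
              restrict R M ∋⟨ a , b ⟩ → R ∋⟨ a , b ⟩ × a ∈ M × b ∈ M
∋-restrict⁻ R M t with to T-∧ (to (∋-tabulate λ a b → R ⟪ a , b ⟫ ∧ lookup M a ∧ lookup M b) t)
... | r , m with to T-∧ m
... | p , q = r , from ∈⇔T p , from ∈⇔T q

∋-restrict⁺ : (R : Rel n) (M : Subset n) {a b : Fin n} →
              R ∋⟨ a , b ⟩ × a ∈ M × b ∈ M → restrict R M ∋⟨ a , b ⟩
∋-restrict⁺ R M (r , p , q) =
  from (∋-tabulate λ a b → R ⟪ a , b ⟫ ∧ lookup M a ∧ lookup M b)
       (from T-∧ (r , from T-∧ (to ∈⇔T p , to ∈⇔T q)))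

∋-dual⁻ : (R : Rel n) {a b : Fin n} → dual R ∋⟨ a , b ⟩ → R ∋⟨ b , a ⟩
∋-dual⁻ R = to (∋-tabulate λ a b → R ⟪ b , a ⟫)

∋-dual⁺ : (R : Rel n) {a b : Fin n} → R ∋⟨ b , a ⟩ → dual R ∋⟨ a , b ⟩
∋-dual⁺ R = from (∋-tabulate λ a b → R ⟪ b , a ⟫)

∋-∪R⁻ : (R₁ R₂ : Rel n) {a b : Fin n} →
        (R₁ ∪R R₂) ∋⟨ a , b ⟩ → R₁ ∋⟨ a , b ⟩ ⊎ R₂ ∋⟨ a , b ⟩
∋-∪R⁻ R₁ R₂ t = to T-∨ (to (∋-tabulate λ a b → R₁ ⟪ a , b ⟫ ∨ R₂ ⟪ a , b ⟫) t)

∋-∪R⁺ : (R₁ R₂ : Rel n) {a b : Fin n} →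
        R₁ ∋⟨ a , b ⟩ ⊎ R₂ ∋⟨ a , b ⟩ → (R₁ ∪R R₂) ∋⟨ a , b ⟩
∋-∪R⁺ R₁ R₂ r = from (∋-tabulate λ a b → R₁ ⟪ a , b ⟫ ∨ R₂ ⟪ a , b ⟫) (from T-∨ r)

∋-diagPoint⁻ : (y : Fin n) {a b : Fin n} → diagPoint y ∋⟨ a , b ⟩ → a ≡ y × b ≡ y
∋-diagPoint⁻ y t with to T-∧ (to (∋-tabulate λ a b → lookup ⁅ y ⁆ a ∧ lookup ⁅ y ⁆ b) t)
... | p , q = x∈⁅y⁆⇒x≡y y (from ∈⇔T p) , x∈⁅y⁆⇒x≡y y (from ∈⇔T q)

∋-diagPoint⁺ : (y : Fin n) → diagPoint y ∋⟨ y , y ⟩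
∋-diagPoint⁺ y = from (∋-tabulate λ a b → lookup ⁅ y ⁆ a ∧ lookup ⁅ y ⁆ b)
                      (from T-∧ (to ∈⇔T (x∈⁅x⁆ y) , to ∈⇔T (x∈⁅x⁆ y)))

∈-down⁻ : (R : Rel n) (x : Fin n) {a : Fin n} → a ∈ down R x → R ∋⟨ a , x ⟩
∈-down⁻ R x = to (∈-tabulate λ z → R ⟪ z , x ⟫)

∈-down⁺ : (R : Rel n) (x : Fin n) {a : Fin n} → R ∋⟨ a , x ⟩ → a ∈ down R x
∈-down⁺ R x = from (∈-tabulate λ z → R ⟪ z , x ⟫)

private
  τ-entry : Subset n → Subset n → Rel n → Fin n → Fin n → Bool
  τ-entry D U P a b = dual (restrict P D) ⟪ a , b ⟫
    ∨ (lookup D a ∧ lookup U b ∧ not (P ⟪ a , b ⟫))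
    ∨ dual (restrict P U) ⟪ a , b ⟫

τ-Cases : Subset n → Subset n → Rel n → Fin n → Fin n → Set
τ-Cases D U P a b = restrict P D ∋⟨ b , a ⟩ ⊎ (a ∈ D × b ∈ U × ¬ P ∋⟨ a , b ⟩) ⊎ restrict P U ∋⟨ b , a ⟩

∋-τ⁻ : (D U : Subset n) (P : Rel n) {a b : Fin n} → τ D U P ∋⟨ a , b ⟩ → τ-Cases D U P a b
∋-τ⁻ D U P {a} {b} t with to T-∨ (to (∋-tabulate (τ-entry D U P)) t)
... | inj₁ r = inj₁ (∋-dual⁻ (restrict P D) r)
... | inj₂ r with to T-∨ r
... | inj₂ s = inj₂ (inj₂ (∋-dual⁻ (restrict P U) s))
... | inj₁ s with to T-∧ s
... | p , s′ with to T-∧ s′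
... | q , ¬r = inj₂ (inj₁ (from ∈⇔T p , from ∈⇔T q , to T-not ¬r))

∋-τ⁺ : (D U : Subset n) (P : Rel n) {a b : Fin n} → τ-Cases D U P a b → τ D U P ∋⟨ a , b ⟩
∋-τ⁺ D U P {a} {b} t = from (∋-tabulate (τ-entry D U P)) (entry t)
  where
  inD inU dualD cross dualU : Bool
  inD = lookup D a
  inU = lookup U b
  dualD = dual (restrict P D) ⟪ a , b ⟫
  cross = inD ∧ inU ∧ not (P ⟪ a , b ⟫)
  dualU = dual (restrict P U) ⟪ a , b ⟫
  entry : τ-Cases D U P a b → T (dualD ∨ cross ∨ dualU)
  entry (inj₁ r) = from (T-∨ {dualD}) (inj₁ (∋-dual⁺ (restrict P D) r))
  entry (inj₂ (inj₁ (p , q , ¬r))) =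
    from (T-∨ {dualD}) (inj₂ (from (T-∨ {cross} {dualU}) (inj₁
      (from (T-∧ {inD}) (to ∈⇔T p , from (T-∧ {inU}) (to ∈⇔T q , from T-not ¬r))))))
  entry (inj₂ (inj₂ r)) =
    from (T-∨ {dualD}) (inj₂ (from (T-∨ {cross} {dualU}) (inj₂ (∋-dual⁺ (restrict P U) r))))

-- Partial orders

restrict-isPOR : {C M : Subset n} {R : Rel n} → IsPOR C R → M ⊆ C → IsPOR M (restrict R M)
restrict-isPOR {M = M} {R} R-por M⊆C = record
  { support = λ a b t → proj₂ (∋-restrict⁻ R M t)
  ; refl    = λ a a∈M → ∋-restrict⁺ R M (IsPOR.refl R-por a (M⊆C a∈M) , a∈M , a∈M)
  ; antisym = λ a b ab ba →
      IsPOR.antisym R-por a b (proj₁ (∋-restrict⁻ R M ab)) (proj₁ (∋-restrict⁻ R M ba))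
  ; trans   = λ a b c ab bc →
      let (ab′ , a∈M , _) = ∋-restrict⁻ R M ab
          (bc′ , _ , c∈M) = ∋-restrict⁻ R M bc
      in ∋-restrict⁺ R M (IsPOR.trans R-por a b c ab′ bc′ , a∈M , c∈M)
  }

above? : Rel n → Subset n → Fin n → Bool
above? S M a = isYes (any? λ z → z ∈? M ×-dec T? (S ⟪ z , a ⟫))

upClosure : Rel n → Subset n → Subset n
upClosure S M = tabulate (above? S M)

∈-upClosure⁻ : (S : Rel n) (M : Subset n) {a : Fin n} →
               a ∈ upClosure S M → ∃ λ z → z ∈ M × S ∋⟨ z , a ⟩
∈-upClosure⁻ S M p = toWitness (to (∈-tabulate (above? S M)) p)

∈-upClosure⁺ : (S : Rel n) (M : Subset n) {a : Fin n} →
               (∃ λ z → z ∈ M × S ∋⟨ z , a ⟩) → a ∈ upClosure S M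
∈-upClosure⁺ S M w = from (∈-tabulate (above? S M)) (fromWitness w)

module _ {C : Subset n} {S : Rel n} (S-por : IsPOR C S) where

  upClosure-upperEnd : (M : Subset n) → UpperEnd S (upClosure S M)
  upClosure-upperEnd M a b a≤b a∈↑M with ∈-upClosure⁻ S M a∈↑M
  ... | z , z∈M , z≤a = ∈-upClosure⁺ S M (z , z∈M , IsPOR.trans S-por z a b z≤a a≤b)

  ⊆-upClosure : {M : Subset n} → M ⊆ C → M ⊆ upClosure S M
  ⊆-upClosure M⊆C {a} a∈M = ∈-upClosure⁺ S _ (a , a∈M , IsPOR.refl S-por a (M⊆C a∈M))

  ∃-maximal-above : {x : Fin n} → x ∈ C → ∃ λ m → S ∋⟨ x , m ⟩ × IsMax C S m
  ∃-maximal-above {x} = go x (⊂-wellFounded (upSet x))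
    where
    upSet : Fin n → Subset n
    upSet x = down (dual S) x

    go : ∀ x → Acc _⊂_ (upSet x) → x ∈ C → ∃ λ m → S ∋⟨ x , m ⟩ × IsMax C S m
    go x (acc smaller) x∈C with any? (λ z → T? (S ⟪ x , z ⟫) ×-dec ¬? (z ≟ x))
    ... | no ∄z = x , IsPOR.refl S-por x x∈C , x∈C , maximal
      where
      maximal : ∀ z → S ∋⟨ x , z ⟩ → z ≡ x
      maximal z x≤z with z ≟ x
      ... | yes z≡x = z≡x
      ... | no  z≢x = ⊥-elim (∄z (z , x≤z , z≢x))
    ... | yes (z , x≤z , z≢x) with go z (smaller upSet-z⊂upSet-x) (proj₂ (IsPOR.support S-por x z x≤z))
      where
      upSet⁻ : ∀ {u v} → v ∈ upSet u → S ∋⟨ u , v ⟩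
      upSet⁻ {u} p = ∋-dual⁻ S (∈-down⁻ (dual S) u p)
      upSet⁺ : ∀ {u v} → S ∋⟨ u , v ⟩ → v ∈ upSet u
      upSet⁺ {u} r = ∈-down⁺ (dual S) u (∋-dual⁺ S r)
      upSet-z⊂upSet-x : upSet z ⊂ upSet x
      upSet-z⊂upSet-x =
        (λ p → upSet⁺ (IsPOR.trans S-por x z _ x≤z (upSet⁻ p))) ,
        x , upSet⁺ (IsPOR.refl S-por x x∈C) ,
        (λ p → z≢x (IsPOR.antisym S-por z x (upSet⁻ p) x≤z))
    ... | m , z≤m , m-max = m , IsPOR.trans S-por x z m x≤z z≤m , m-max

-- The involution τ on 𝔘(D, U)

module _ {D U : Subset n} (D∩U=∅ : Empty (D ∩ U)) where

  private
    disjoint : ∀ {a} → a ∈ D → a ∈ U → ⊥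
    disjoint p q = D∩U=∅ (_ , x∈p∩q⁺ (p , q))

  τ-support : (P : Rel n) {a b : Fin n} → τ D U P ∋⟨ a , b ⟩ →
              (a ∈ D ⊎ a ∈ U) × (b ∈ D ⊎ b ∈ U)
  τ-support P t with ∋-τ⁻ D U P t
  ... | inj₁ r                  = let (_ , b∈D , a∈D) = ∋-restrict⁻ P D r in inj₁ a∈D , inj₁ b∈D
  ... | inj₂ (inj₁ (a∈D , b∈U , _)) = inj₁ a∈D , inj₂ b∈U
  ... | inj₂ (inj₂ r)           = let (_ , b∈U , a∈U) = ∋-restrict⁻ P U r in inj₂ a∈U , inj₂ b∈U

  τ-DD : (P : Rel n) {a b : Fin n} → a ∈ D → b ∈ D → τ D U P ∋⟨ a , b ⟩ ⇔ P ∋⟨ b , a ⟩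
  τ-DD P {a} {b} a∈D b∈D =
    mk⇔ to′ (λ r → ∋-τ⁺ D U P (inj₁ (∋-restrict⁺ P D (r , b∈D , a∈D))))
    where
    to′ : τ D U P ∋⟨ a , b ⟩ → P ∋⟨ b , a ⟩
    to′ t with ∋-τ⁻ D U P t
    ... | inj₁ r                  = proj₁ (∋-restrict⁻ P D r)
    ... | inj₂ (inj₁ (_ , b∈U , _)) = ⊥-elim (disjoint b∈D b∈U)
    ... | inj₂ (inj₂ r)           = ⊥-elim (disjoint a∈D (proj₂ (proj₂ (∋-restrict⁻ P U r))))

  τ-DU : (P : Rel n) {a b : Fin n} → a ∈ D → b ∈ U → τ D U P ∋⟨ a , b ⟩ ⇔ (¬ P ∋⟨ a , b ⟩)
  τ-DU P {a} {b} a∈D b∈U = mk⇔ to′ (λ ¬r → ∋-τ⁺ D U P (inj₂ (inj₁ (a∈D , b∈U , ¬r))))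
    where
    to′ : τ D U P ∋⟨ a , b ⟩ → ¬ P ∋⟨ a , b ⟩
    to′ t with ∋-τ⁻ D U P t
    ... | inj₁ r                   = ⊥-elim (disjoint (proj₁ (proj₂ (∋-restrict⁻ P D r))) b∈U)
    ... | inj₂ (inj₁ (_ , _ , ¬r)) = ¬r
    ... | inj₂ (inj₂ r)            = ⊥-elim (disjoint a∈D (proj₂ (proj₂ (∋-restrict⁻ P U r))))

  τ-UD : (P : Rel n) {a b : Fin n} → a ∈ U → b ∈ D → ¬ τ D U P ∋⟨ a , b ⟩
  τ-UD P a∈U b∈D t with ∋-τ⁻ D U P t
  ... | inj₁ r                    = disjoint (proj₂ (proj₂ (∋-restrict⁻ P D r))) a∈U
  ... | inj₂ (inj₁ (a∈D , _ , _)) = disjoint a∈D a∈U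
  ... | inj₂ (inj₂ r)             = disjoint b∈D (proj₁ (proj₂ (∋-restrict⁻ P U r)))

  τ-UU : (P : Rel n) {a b : Fin n} → a ∈ U → b ∈ U → τ D U P ∋⟨ a , b ⟩ ⇔ P ∋⟨ b , a ⟩
  τ-UU P {a} {b} a∈U b∈U =
    mk⇔ to′ (λ r → ∋-τ⁺ D U P (inj₂ (inj₂ (∋-restrict⁺ P U (r , b∈U , a∈U)))))
    where
    to′ : τ D U P ∋⟨ a , b ⟩ → P ∋⟨ b , a ⟩
    to′ t with ∋-τ⁻ D U P t
    ... | inj₁ r                    = ⊥-elim (disjoint (proj₂ (proj₂ (∋-restrict⁻ P D r))) a∈U)
    ... | inj₂ (inj₁ (a∈D , _ , _)) = ⊥-elim (disjoint a∈D a∈U)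
    ... | inj₂ (inj₂ r)             = proj₁ (∋-restrict⁻ P U r)

  τ-upperEnd : (P : Rel n) → UpperEnd (τ D U P) U
  τ-upperEnd P a b t a∈U with proj₂ (τ-support P t)
  ... | inj₁ b∈D = ⊥-elim (τ-UD P a∈U b∈D t)
  ... | inj₂ b∈U = b∈U

  τ-isPOR : {P : Rel n} → IsPOR (D ∪ U) P → IsPOR (D ∪ U) (τ D U P)
  τ-isPOR {P} P-por = record
    { support = λ a b t → let (a∈ , b∈) = τ-support P t in x∈p∪q⁺ a∈ , x∈p∪q⁺ b∈
    ; refl    = reflexive
    ; antisym = antisymmetric
    ; trans   = transitive
    }
    where
    open IsPOR P-por using () renaming (refl to P-refl; antisym to P-antisym; trans to P-trans)

    reflexive : ∀ a → a ∈ D ∪ U → τ D U P ∋⟨ a , a ⟩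
    reflexive a a∈ with x∈p∪q⁻ D U a∈
    ... | inj₁ a∈D = from (τ-DD P a∈D a∈D) (P-refl a a∈)
    ... | inj₂ a∈U = from (τ-UU P a∈U a∈U) (P-refl a a∈)

    antisymmetric : ∀ a b → τ D U P ∋⟨ a , b ⟩ → τ D U P ∋⟨ b , a ⟩ → a ≡ b
    antisymmetric a b ab ba with τ-support P ab
    ... | inj₁ a∈D , inj₁ b∈D = P-antisym a b (to (τ-DD P b∈D a∈D) ba) (to (τ-DD P a∈D b∈D) ab)
    ... | inj₁ a∈D , inj₂ b∈U = ⊥-elim (τ-UD P b∈U a∈D ba)
    ... | inj₂ a∈U , inj₁ b∈D = ⊥-elim (τ-UD P a∈U b∈D ab)
    ... | inj₂ a∈U , inj₂ b∈U = P-antisym a b (to (τ-UU P b∈U a∈U) ba) (to (τ-UU P a∈U b∈U) ab)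

    transitive : ∀ a b c → τ D U P ∋⟨ a , b ⟩ → τ D U P ∋⟨ b , c ⟩ → τ D U P ∋⟨ a , c ⟩
    transitive a b c ab bc with τ-support P ab | proj₂ (τ-support P bc)
    ... | inj₁ a∈D , inj₁ b∈D | inj₁ c∈D =
      from (τ-DD P a∈D c∈D) (P-trans c b a (to (τ-DD P b∈D c∈D) bc) (to (τ-DD P a∈D b∈D) ab))
    ... | inj₁ a∈D , inj₁ b∈D | inj₂ c∈U =
      from (τ-DU P a∈D c∈U) λ ac →
        to (τ-DU P b∈D c∈U) bc (P-trans b a c (to (τ-DD P a∈D b∈D) ab) ac)
    ... | inj₁ a∈D , inj₂ b∈U | inj₁ c∈D = ⊥-elim (τ-UD P b∈U c∈D bc)
    ... | inj₁ a∈D , inj₂ b∈U | inj₂ c∈U =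
      from (τ-DU P a∈D c∈U) λ ac →
        to (τ-DU P a∈D b∈U) ab (P-trans a c b ac (to (τ-UU P b∈U c∈U) bc))
    ... | inj₂ a∈U , inj₁ b∈D | _        = ⊥-elim (τ-UD P a∈U b∈D ab)
    ... | inj₂ a∈U , inj₂ b∈U | inj₁ c∈D = ⊥-elim (τ-UD P b∈U c∈D bc)
    ... | inj₂ a∈U , inj₂ b∈U | inj₂ c∈U =
      from (τ-UU P a∈U c∈U) (P-trans c b a (to (τ-UU P b∈U c∈U) bc) (to (τ-UU P a∈U b∈U) ab))

  τ-involutive : {P : Rel n} → 𝔘 D U P → τ D U (τ D U P) ≡ P
  τ-involutive {P} (P-por , U-upper) = Rel-ext λ a b → mk⇔ (to′ a b) (from′ a b)
    where
    to′ : ∀ a b → τ D U (τ D U P) ∋⟨ a , b ⟩ → P ∋⟨ a , b ⟩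
    to′ a b t with τ-support (τ D U P) t
    ... | inj₁ a∈D , inj₁ b∈D = to (τ-DD P b∈D a∈D) (to (τ-DD (τ D U P) a∈D b∈D) t)
    ... | inj₁ a∈D , inj₂ b∈U with T? (P ⟪ a , b ⟫)
    ...   | yes ab = ab
    ...   | no ¬ab = ⊥-elim (to (τ-DU (τ D U P) a∈D b∈U) t (from (τ-DU P a∈D b∈U) ¬ab))
    to′ a b t | inj₂ a∈U , inj₁ b∈D = ⊥-elim (τ-UD (τ D U P) a∈U b∈D t)
    to′ a b t | inj₂ a∈U , inj₂ b∈U = to (τ-UU P b∈U a∈U) (to (τ-UU (τ D U P) a∈U b∈U) t)

    from′ : ∀ a b → P ∋⟨ a , b ⟩ → τ D U (τ D U P) ∋⟨ a , b ⟩
    from′ a b ab with IsPOR.support P-por a b ab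
    ... | a∈ , b∈ with x∈p∪q⁻ D U a∈ | x∈p∪q⁻ D U b∈
    ... | inj₁ a∈D | inj₁ b∈D = from (τ-DD (τ D U P) a∈D b∈D) (from (τ-DD P b∈D a∈D) ab)
    ... | inj₁ a∈D | inj₂ b∈U = from (τ-DU (τ D U P) a∈D b∈U) (λ t → to (τ-DU P a∈D b∈U) t ab)
    ... | inj₂ a∈U | inj₁ b∈D = ⊥-elim (disjoint b∈D (U-upper a b ab a∈U))
    ... | inj₂ a∈U | inj₂ b∈U = from (τ-UU (τ D U P) a∈U b∈U) (from (τ-UU P b∈U a∈U) ab)

-- Adjoining a top element

_×R_ : Subset n → Subset n → Rel n
M ×R N = tabulate λ a → tabulate λ b → lookup M a ∧ lookup N b

∋-×R⁻ : (M N : Subset n) {a b : Fin n} → (M ×R N) ∋⟨ a , b ⟩ → a ∈ M × b ∈ N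
∋-×R⁻ M N t with to T-∧ (to (∋-tabulate λ a b → lookup M a ∧ lookup N b) t)
... | p , q = from ∈⇔T p , from ∈⇔T q

∋-×R⁺ : (M N : Subset n) {a b : Fin n} → a ∈ M × b ∈ N → (M ×R N) ∋⟨ a , b ⟩
∋-×R⁺ M N (p , q) =
  from (∋-tabulate λ a b → lookup M a ∧ lookup N b) (from T-∧ (to ∈⇔T p , to ∈⇔T q))

adjoinTop : Fin n → Subset n → Rel n → Rel n
adjoinTop y D P = P ∪R ((D ∪ ⁅ y ⁆) ×R ⁅ y ⁆)

∋-adjoinTop⁻ : (y : Fin n) (D : Subset n) (P : Rel n) {a b : Fin n} →
               adjoinTop y D P ∋⟨ a , b ⟩ → P ∋⟨ a , b ⟩ ⊎ (b ≡ y × (a ∈ D ⊎ a ≡ y))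
∋-adjoinTop⁻ y D P t with ∋-∪R⁻ P ((D ∪ ⁅ y ⁆) ×R ⁅ y ⁆) t
... | inj₁ r = inj₁ r
... | inj₂ c =
  let (a∈ , b∈) = ∋-×R⁻ (D ∪ ⁅ y ⁆) ⁅ y ⁆ c
  in inj₂ (x∈⁅y⁆⇒x≡y y b∈ , x∈p∪⁅y⁆⁻ D a∈)

∋-adjoinTop⁺ : (y : Fin n) (D : Subset n) (P : Rel n) {a b : Fin n} →
               P ∋⟨ a , b ⟩ ⊎ (b ≡ y × (a ∈ D ⊎ a ≡ y)) → adjoinTop y D P ∋⟨ a , b ⟩
∋-adjoinTop⁺ y D P (inj₁ r) = ∋-∪R⁺ P ((D ∪ ⁅ y ⁆) ×R ⁅ y ⁆) (inj₁ r)
∋-adjoinTop⁺ y D P (inj₂ (refl , a∈)) =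
  ∋-∪R⁺ P ((D ∪ ⁅ y ⁆) ×R ⁅ y ⁆) (inj₂ (∋-×R⁺ (D ∪ ⁅ y ⁆) ⁅ y ⁆ (x∈p∪⁅y⁆⁺ a∈ , x∈⁅x⁆ y)))

module _ {W : Subset n} {y : Fin n} {P : Rel n} (P-por : IsPOR W P) (y∉W : y ∉ W) where

  private
    y∉dom : ∀ {a b} → P ∋⟨ a , b ⟩ → a ≡ y → ⊥
    y∉dom {a} {b} r refl = y∉W (proj₁ (IsPOR.support P-por a b r))
    y∉cod : ∀ {a b} → P ∋⟨ a , b ⟩ → b ≡ y → ⊥
    y∉cod {a} {b} r refl = y∉W (proj₂ (IsPOR.support P-por a b r))

  restrict-adjoinTop : (D : Subset n) → restrict (adjoinTop y D P) W ≡ P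
  restrict-adjoinTop D = Rel-ext λ a b → mk⇔ (to′ a b) (from′ a b)
    where
    to′ : ∀ a b → restrict (adjoinTop y D P) W ∋⟨ a , b ⟩ → P ∋⟨ a , b ⟩
    to′ a b t with ∋-restrict⁻ (adjoinTop y D P) W t
    ... | r , _ , b∈W with ∋-adjoinTop⁻ y D P r
    ... | inj₁ ab       = ab
    ... | inj₂ (refl , _) = ⊥-elim (y∉W b∈W)
    from′ : ∀ a b → P ∋⟨ a , b ⟩ → restrict (adjoinTop y D P) W ∋⟨ a , b ⟩
    from′ a b ab =
      ∋-restrict⁺ (adjoinTop y D P) W (∋-adjoinTop⁺ y D P (inj₁ ab) , IsPOR.support P-por a b ab)

  ∈-down-adjoinTop : (D : Subset n) {a : Fin n} → a ∈ down (adjoinTop y D P) y ⇔ (a ∈ D ⊎ a ≡ y)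
  ∈-down-adjoinTop D =
    mk⇔ to′ (λ a∈ → ∈-down⁺ (adjoinTop y D P) y (∋-adjoinTop⁺ y D P (inj₂ (refl , a∈))))
    where
    to′ : ∀ {a} → a ∈ down (adjoinTop y D P) y → a ∈ D ⊎ a ≡ y
    to′ a∈ with ∋-adjoinTop⁻ y D P (∈-down⁻ (adjoinTop y D P) y a∈)
    ... | inj₁ ay        = ⊥-elim (y∉cod ay refl)
    ... | inj₂ (_ , a∈′) = a∈′

  adjoinTop-isPOR : {D : Subset n} → D ⊆ W → UpperEnd (dual P) D → IsPOR (W ∪ ⁅ y ⁆) (adjoinTop y D P)
  adjoinTop-isPOR {D} D⊆W D-downward = record
    { support = support
    ; refl    = reflexive
    ; antisym = antisymmetric
    ; trans   = transitive
    }
    where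
    open IsPOR P-por using ()
      renaming (support to P-support; refl to P-refl; antisym to P-antisym; trans to P-trans)
    R : Rel n
    R = adjoinTop y D P
    cone : ∀ {a b} → b ≡ y → a ∈ D ⊎ a ≡ y → R ∋⟨ a , b ⟩
    cone b≡y a∈ = ∋-adjoinTop⁺ y D P (inj₂ (b≡y , a∈))
    W⁺ : ∀ {a} → a ∈ W → a ∈ W ∪ ⁅ y ⁆
    W⁺ a∈W = x∈p∪⁅y⁆⁺ (inj₁ a∈W)
    y⁺ : ∀ {a} → a ≡ y → a ∈ W ∪ ⁅ y ⁆
    y⁺ a≡y = x∈p∪⁅y⁆⁺ (inj₂ a≡y)

    support : ∀ a b → R ∋⟨ a , b ⟩ → a ∈ W ∪ ⁅ y ⁆ × b ∈ W ∪ ⁅ y ⁆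
    support a b t with ∋-adjoinTop⁻ y D P t
    ... | inj₁ ab               = let (a∈W , b∈W) = P-support a b ab in W⁺ a∈W , W⁺ b∈W
    ... | inj₂ (b≡y , inj₁ a∈D) = W⁺ (D⊆W a∈D) , y⁺ b≡y
    ... | inj₂ (b≡y , inj₂ a≡y) = y⁺ a≡y , y⁺ b≡y

    reflexive : ∀ a → a ∈ W ∪ ⁅ y ⁆ → R ∋⟨ a , a ⟩
    reflexive a a∈ with x∈p∪⁅y⁆⁻ W a∈
    ... | inj₁ a∈W = ∋-adjoinTop⁺ y D P (inj₁ (P-refl a a∈W))
    ... | inj₂ a≡y = cone a≡y (inj₂ a≡y)

    antisymmetric : ∀ a b → R ∋⟨ a , b ⟩ → R ∋⟨ b , a ⟩ → a ≡ b
    antisymmetric a b ab ba with ∋-adjoinTop⁻ y D P ab | ∋-adjoinTop⁻ y D P ba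
    ... | inj₁ ab′       | inj₁ ba′       = P-antisym a b ab′ ba′
    ... | inj₁ ab′       | inj₂ (a≡y , _) = ⊥-elim (y∉dom ab′ a≡y)
    ... | inj₂ (b≡y , _) | inj₁ ba′       = ⊥-elim (y∉dom ba′ b≡y)
    ... | inj₂ (b≡y , _) | inj₂ (a≡y , _) = trans a≡y (sym b≡y)

    transitive : ∀ a b c → R ∋⟨ a , b ⟩ → R ∋⟨ b , c ⟩ → R ∋⟨ a , c ⟩
    transitive a b c ab bc with ∋-adjoinTop⁻ y D P ab | ∋-adjoinTop⁻ y D P bc
    ... | inj₁ ab′       | inj₁ bc′              = ∋-adjoinTop⁺ y D P (inj₁ (P-trans a b c ab′ bc′))
    ... | inj₁ ab′       | inj₂ (c≡y , inj₁ b∈D) = cone c≡y (inj₁ (D-downward b a (∋-dual⁺ P ab′) b∈D))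
    ... | inj₁ ab′       | inj₂ (_ , inj₂ b≡y)   = ⊥-elim (y∉cod ab′ b≡y)
    ... | inj₂ (b≡y , _) | inj₁ bc′              = ⊥-elim (y∉dom bc′ b≡y)
    ... | inj₂ (_ , a∈)  | inj₂ (c≡y , _)        = cone c≡y a∈

adjoinTop-restrict-down : {W : Subset n} {y : Fin n} {R : Rel n} →
                          IsPOR (W ∪ ⁅ y ⁆) R → (∀ b → R ∋⟨ y , b ⟩ → b ≡ y) →
                          adjoinTop y (W ∩ down R y) (restrict R W) ≡ R
adjoinTop-restrict-down {n = n} {W = W} {y} {R} R-por y-maximal = Rel-ext λ a b → mk⇔ (to′ a b) (from′ a b)
  where
  R′ : Rel n
  R′ = adjoinTop y (W ∩ down R y) (restrict R W)

  R′⁺ : ∀ {a b} → restrict R W ∋⟨ a , b ⟩ ⊎ (b ≡ y × (a ∈ W ∩ down R y ⊎ a ≡ y)) → R′ ∋⟨ a , b ⟩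
  R′⁺ = ∋-adjoinTop⁺ y (W ∩ down R y) (restrict R W)

  to′ : ∀ a b → R′ ∋⟨ a , b ⟩ → R ∋⟨ a , b ⟩
  to′ a b t with ∋-adjoinTop⁻ y (W ∩ down R y) (restrict R W) t
  ... | inj₁ ab                 = proj₁ (∋-restrict⁻ R W ab)
  ... | inj₂ (refl , inj₁ a∈D)  = ∈-down⁻ R y (proj₂ (x∈p∩q⁻ W (down R y) a∈D))
  ... | inj₂ (refl , inj₂ refl) = IsPOR.refl R-por y (x∈p∪⁅y⁆⁺ (inj₂ refl))

  from′ : ∀ a b → R ∋⟨ a , b ⟩ → R′ ∋⟨ a , b ⟩
  from′ a b ab with IsPOR.support R-por a b ab
  ... | a∈ , b∈ with x∈p∪⁅y⁆⁻ W a∈ | x∈p∪⁅y⁆⁻ W b∈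
  ... | inj₁ a∈W  | inj₁ b∈W  = R′⁺ (inj₁ (∋-restrict⁺ R W (ab , a∈W , b∈W)))
  ... | inj₁ a∈W  | inj₂ refl = R′⁺ (inj₂ (refl , inj₁ (x∈p∩q⁺ (a∈W , ∈-down⁺ R y ab))))
  ... | inj₂ refl | _         = R′⁺ (inj₂ (y-maximal b ab , inj₂ refl))

-- The bijection σ

module Bijection (X Z : Subset n) (Q : Rel n) (y : Fin n)
                 (X∩Z=∅ : Empty (X ∩ Z)) (Q-por : IsPOR Z Q) (y∉X : y ∉ X) (y∉Z : y ∉ Z) where

  W Y : Subset n
  W = X ∪ Z
  Y = Z ∪ ⁅ y ⁆

  Q⁺ : Rel n
  Q⁺ = Q ∪R diagPoint y

  σ⁻¹ : Rel n → Rel n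
  σ⁻¹ S = adjoinTop y (W ─ upClosure S Z) (τ (W ─ upClosure S Z) (upClosure S Z) S)

  X∪Y≡W∪y : X ∪ Y ≡ W ∪ ⁅ y ⁆
  X∪Y≡W∪y = sym (∪-assoc X Z ⁅ y ⁆)

  y∉W : y ∉ W
  y∉W y∈W with x∈p∪q⁻ X Z y∈W
  ... | inj₁ y∈X = y∉X y∈X
  ... | inj₂ y∈Z = y∉Z y∈Z

  ∈W⇒≢y : ∀ {a} → a ∈ W → a ≡ y → ⊥
  ∈W⇒≢y a∈W refl = y∉W a∈W

  X⊆W : X ⊆ W
  X⊆W = p⊆p∪q Z

  Z⊆W : Z ⊆ W
  Z⊆W = q⊆p∪q X Z

  Z⊆Y : Z ⊆ Y
  Z⊆Y = p⊆p∪q ⁅ y ⁆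

  y∈Y : y ∈ Y
  y∈Y = q⊆p∪q Z ⁅ y ⁆ (x∈⁅x⁆ y)

  Y-cases : ∀ {a} → a ∈ Y → a ∈ Z ⊎ a ≡ y
  Y-cases = x∈p∪⁅y⁆⁻ Z

  W∩Y⊆Z : ∀ {a} → a ∈ W → a ∈ Y → a ∈ Z
  W∩Y⊆Z a∈W a∈Y with Y-cases a∈Y
  ... | inj₁ a∈Z = a∈Z
  ... | inj₂ a≡y = ⊥-elim (∈W⇒≢y a∈W a≡y)

  ∋-Q⁺⁻ : ∀ {a b} → Q⁺ ∋⟨ a , b ⟩ → Q ∋⟨ a , b ⟩ ⊎ (a ≡ y × b ≡ y)
  ∋-Q⁺⁻ q with ∋-∪R⁻ Q (diagPoint y) q
  ... | inj₁ ab = inj₁ ab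
  ... | inj₂ yy = inj₂ (∋-diagPoint⁻ y yy)

  ∋-Q⁺⁺ : ∀ {a b} → Q ∋⟨ a , b ⟩ ⊎ (a ≡ y × b ≡ y) → Q⁺ ∋⟨ a , b ⟩
  ∋-Q⁺⁺ (inj₁ ab)           = ∋-∪R⁺ Q (diagPoint y) (inj₁ ab)
  ∋-Q⁺⁺ (inj₂ (refl , refl)) = ∋-∪R⁺ Q (diagPoint y) (inj₂ (∋-diagPoint⁺ y))

  Q⁺⇒Q : ∀ {a b} → a ∈ Z → Q⁺ ∋⟨ a , b ⟩ → Q ∋⟨ a , b ⟩
  Q⁺⇒Q a∈Z q with ∋-Q⁺⁻ q
  ... | inj₁ ab         = ab
  ... | inj₂ (refl , _) = ⊥-elim (y∉Z a∈Z)

  y-maximal-in-Q⁺ : IsMax Y Q⁺ y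
  y-maximal-in-Q⁺ = y∈Y , λ b q → y-top (∋-Q⁺⁻ q)
    where
    y-top : ∀ {b} → Q ∋⟨ y , b ⟩ ⊎ (y ≡ y × b ≡ y) → b ≡ y
    y-top {b} (inj₁ yb)        = ⊥-elim (y∉Z (proj₁ (IsPOR.support Q-por y b yb)))
    y-top     (inj₂ (_ , b≡y)) = b≡y

  module Forward {R : Rel n} (R∈𝔐* : 𝔐* Q⁺ X Y R) where

    R-por : IsPOR (X ∪ Y) R
    R-por = proj₁ (proj₁ R∈𝔐*)

    R-por′ : IsPOR (W ∪ ⁅ y ⁆) R
    R-por′ = subst (λ C → IsPOR C R) X∪Y≡W∪y R-por

    R-on-Y : ∀ {a b} → a ∈ Y → b ∈ Y → R ∋⟨ a , b ⟩ ⇔ Q⁺ ∋⟨ a , b ⟩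
    R-on-Y {a} {b} a∈Y b∈Y = mk⇔
      (λ ab → subst (_∋⟨ a , b ⟩) R|Y≡Q⁺ (∋-restrict⁺ R Y (ab , a∈Y , b∈Y)))
      (λ ab → proj₁ (∋-restrict⁻ R Y (subst (_∋⟨ a , b ⟩) (sym R|Y≡Q⁺) ab)))
      where
      R|Y≡Q⁺ : restrict R Y ≡ Q⁺
      R|Y≡Q⁺ = proj₁ (proj₂ (proj₁ R∈𝔐*))

    R-on-Z : ∀ {a b} → a ∈ Z → b ∈ Z → R ∋⟨ a , b ⟩ ⇔ Q ∋⟨ a , b ⟩
    R-on-Z a∈Z b∈Z = mk⇔
      (λ ab → Q⁺⇒Q a∈Z (to (R-on-Y (Z⊆Y a∈Z) (Z⊆Y b∈Z)) ab))
      (λ ab → from (R-on-Y (Z⊆Y a∈Z) (Z⊆Y b∈Z)) (∋-Q⁺⁺ (inj₁ ab)))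

    Z≰y : ∀ {a} → a ∈ Z → ¬ R ∋⟨ a , y ⟩
    Z≰y {a} a∈Z ay =
      y∉Z (proj₂ (IsPOR.support Q-por a y (Q⁺⇒Q a∈Z (to (R-on-Y (Z⊆Y a∈Z) y∈Y) ay))))

    y-maximal : ∀ b → R ∋⟨ y , b ⟩ → b ≡ y
    y-maximal = proj₂ (to (proj₂ R∈𝔐* y) y-maximal-in-Q⁺)

    -- a lies below a maximal point of R, which is maximal in Q⁺ and so lies in Z ∪ {y}.
    X-below-Z : ∀ {a} → a ∈ X → ¬ R ∋⟨ a , y ⟩ → ∃ λ z → z ∈ Z × R ∋⟨ a , z ⟩
    X-below-Z a∈X a≰y with ∃-maximal-above R-por (p⊆p∪q Y a∈X)
    ... | m , am , m-max with Y-cases (proj₁ (from (proj₂ R∈𝔐* m) m-max))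
    ... | inj₁ m∈Z = m , m∈Z , am
    ... | inj₂ refl = ⊥-elim (a≰y am)

    D U : Subset n
    D = W ∩ down R y
    U = W ─ down R y

    P : Rel n
    P = restrict R W

    D∩U≡∅ : Empty (D ∩ U)
    D∩U≡∅ = p∩q∩[r─q]≡∅ W (down R y) W

    ∈U⁻ : ∀ {a} → a ∈ U → a ∈ W × ¬ R ∋⟨ a , y ⟩
    ∈U⁻ a∈U = let (a∈W , a∉↓y) = x∈p─q⁻ W (down R y) a∈U in
              a∈W , λ ay → a∉↓y (∈-down⁺ R y ay)

    ∈U⁺ : ∀ {a} → a ∈ W → ¬ R ∋⟨ a , y ⟩ → a ∈ U
    ∈U⁺ a∈W a≰y = x∈p∧x∉q⇒x∈p─q a∈W (λ a∈↓y → a≰y (∈-down⁻ R y a∈↓y))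

    P-𝔘 : 𝔘 D U P
    P-𝔘 = subst (λ C → IsPOR C P) (sym (p∩q∪p─q≡p W (down R y)))
                (restrict-isPOR R-por′ (p⊆p∪q ⁅ y ⁆))
        , U-upper
      where
      U-upper : UpperEnd P U
      U-upper a b ab a∈U = let (ab′ , _ , b∈W) = ∋-restrict⁻ R W ab in
        ∈U⁺ b∈W (λ by → proj₂ (∈U⁻ a∈U) (IsPOR.trans R-por′ a b y ab′ by))

    Z⊆U : Z ⊆ U
    Z⊆U a∈Z = ∈U⁺ (Z⊆W a∈Z) (Z≰y a∈Z)

    σR-on-U : ∀ {a b} → a ∈ U → b ∈ U → σ W y R ∋⟨ a , b ⟩ ⇔ R ∋⟨ b , a ⟩
    σR-on-U a∈U b∈U = mk⇔
      (λ ab → proj₁ (∋-restrict⁻ R W (to (τ-UU D∩U≡∅ P a∈U b∈U) ab)))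
      (λ ba → from (τ-UU D∩U≡∅ P a∈U b∈U)
                   (∋-restrict⁺ R W (ba , proj₁ (∈U⁻ b∈U) , proj₁ (∈U⁻ a∈U))))

    upClosure-σR≡U : upClosure (σ W y R) Z ≡ U
    upClosure-σR≡U = ⊆-antisym ⊆U U⊆
      where
      ⊆U : upClosure (σ W y R) Z ⊆ U
      ⊆U a∈ with ∈-upClosure⁻ (σ W y R) Z a∈
      ... | z , z∈Z , za = τ-upperEnd D∩U≡∅ P z _ za (Z⊆U z∈Z)
      U⊆ : U ⊆ upClosure (σ W y R) Z
      U⊆ {a} a∈U with ∈U⁻ a∈U
      ... | a∈W , a≰y with x∈p∪q⁻ X Z a∈W
      ... | inj₂ a∈Z = ∈-upClosure⁺ (σ W y R) Z (a , a∈Z , from (σR-on-U a∈U a∈U) aa)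
        where
        aa : R ∋⟨ a , a ⟩
        aa = IsPOR.refl R-por′ a (p⊆p∪q ⁅ y ⁆ a∈W)
      ... | inj₁ a∈X with X-below-Z a∈X a≰y
      ... | z , z∈Z , az = ∈-upClosure⁺ (σ W y R) Z (z , z∈Z , from (σR-on-U (Z⊆U z∈Z) a∈U) az)

    σR-ℭ : ℭ (dual Q) X Z (σ W y R)
    σR-ℭ = σR-por , Rel-ext σR-on-Z , Z-convex
      where
      σR-por : IsPOR W (σ W y R)
      σR-por = subst (λ C → IsPOR C (σ W y R)) (p∩q∪p─q≡p W (down R y))
                     (τ-isPOR D∩U≡∅ (proj₁ P-𝔘))

      σR-on-Z : ∀ a b → restrict (σ W y R) Z ∋⟨ a , b ⟩ ⇔ dual Q ∋⟨ a , b ⟩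
      σR-on-Z a b = mk⇔
        (λ t → let (ab , a∈Z , b∈Z) = ∋-restrict⁻ (σ W y R) Z t in
               ∋-dual⁺ Q (to (R-on-Z b∈Z a∈Z) (to (σR-on-U (Z⊆U a∈Z) (Z⊆U b∈Z)) ab)))
        (λ t → let ba = ∋-dual⁻ Q t ; (b∈Z , a∈Z) = IsPOR.support Q-por b a ba in
               ∋-restrict⁺ (σ W y R) Z
                 (from (σR-on-U (Z⊆U a∈Z) (Z⊆U b∈Z)) (from (R-on-Z b∈Z a∈Z) ba) , a∈Z , b∈Z))

      Z-convex : Convex (σ W y R) Z
      Z-convex a x b ax xb a∈Z b∈Z =
        W∩Y⊆Z (proj₁ (∈U⁻ x∈U)) (Y-convex b x a bx xa (Z⊆Y b∈Z) (Z⊆Y a∈Z))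
        where
        Y-convex : Convex R Y
        Y-convex = proj₂ (proj₂ (proj₁ R∈𝔐*))
        x∈U : x ∈ U
        x∈U = τ-upperEnd D∩U≡∅ P a x ax (Z⊆U a∈Z)
        bx : R ∋⟨ b , x ⟩
        bx = to (σR-on-U x∈U (Z⊆U b∈Z)) xb
        xa : R ∋⟨ x , a ⟩
        xa = to (σR-on-U (Z⊆U a∈Z) x∈U) ax

    σ⁻¹∘σ : σ⁻¹ (σ W y R) ≡ R
    σ⁻¹∘σ = begin
      σ⁻¹ (σ W y R)
        ≡⟨ cong (λ V → adjoinTop y (W ─ V) (τ (W ─ V) V (σ W y R))) upClosure-σR≡U ⟩
      adjoinTop y (W ─ U) (τ (W ─ U) U (τ D U P))
        ≡⟨ cong (λ D′ → adjoinTop y D′ (τ D′ U (τ D U P))) (p─[p─q]≡p∩q W (down R y)) ⟩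
      adjoinTop y D (τ D U (τ D U P))
        ≡⟨ cong (adjoinTop y D) (τ-involutive D∩U≡∅ P-𝔘) ⟩
      adjoinTop y D P
        ≡⟨ adjoinTop-restrict-down R-por′ y-maximal ⟩
      R ∎
      where open ≡-Reasoning

  module Backward {S : Rel n} (S∈ℭ : ℭ (dual Q) X Z S) where

    S-por : IsPOR W S
    S-por = proj₁ S∈ℭ

    S-on-Z : ∀ {a b} → a ∈ Z → b ∈ Z → S ∋⟨ a , b ⟩ ⇔ Q ∋⟨ b , a ⟩
    S-on-Z {a} {b} a∈Z b∈Z = mk⇔
      (λ ab → ∋-dual⁻ Q (subst (_∋⟨ a , b ⟩) S|Z≡Qᵈ (∋-restrict⁺ S Z (ab , a∈Z , b∈Z))))
      (λ ba → proj₁ (∋-restrict⁻ S Z (subst (_∋⟨ a , b ⟩) (sym S|Z≡Qᵈ) (∋-dual⁺ Q ba))))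
      where
      S|Z≡Qᵈ : restrict S Z ≡ dual Q
      S|Z≡Qᵈ = proj₁ (proj₂ S∈ℭ)

    V D : Subset n
    V = upClosure S Z
    D = W ─ V

    V⊆W : V ⊆ W
    V⊆W a∈V = let (z , _ , za) = ∈-upClosure⁻ S Z a∈V in proj₂ (IsPOR.support S-por z _ za)

    Z⊆V : Z ⊆ V
    Z⊆V = ⊆-upClosure S-por Z⊆W

    D∩V≡∅ : Empty (D ∩ V)
    D∩V≡∅ = [p─q]∩q≡∅ W V

    S-𝔘 : 𝔘 D V S
    S-𝔘 = subst (λ C → IsPOR C S) (sym (q⊆p⇒p─q∪q≡p V⊆W)) S-por , upClosure-upperEnd S-por Z

    τS : Rel n
    τS = τ D V S

    τS-por : IsPOR W τS
    τS-por = subst (λ C → IsPOR C τS) (q⊆p⇒p─q∪q≡p V⊆W) (τ-isPOR D∩V≡∅ (proj₁ S-𝔘))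

    τS-on-V : ∀ {a b} → a ∈ V → b ∈ V → τS ∋⟨ a , b ⟩ ⇔ S ∋⟨ b , a ⟩
    τS-on-V = τ-UU D∩V≡∅ S

    D-downward : UpperEnd (dual τS) D
    D-downward a b ba a∈D with x∈p─q⁻ W V a∈D
    ... | _ , a∉V = x∈p∧x∉q⇒x∈p─q (proj₁ (IsPOR.support τS-por b a ba′))
                                   (λ b∈V → a∉V (τ-upperEnd D∩V≡∅ S b a ba′ b∈V))
      where
      ba′ : τS ∋⟨ b , a ⟩
      ba′ = ∋-dual⁻ τS ba

    R : Rel n
    R = σ⁻¹ S

    R-por : IsPOR (X ∪ Y) R
    R-por = subst (λ C → IsPOR C R) (sym X∪Y≡W∪y)
                  (adjoinTop-isPOR τS-por y∉W (p─q⊆p W V) D-downward)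

    ∋-R⁻ : ∀ {a b} → R ∋⟨ a , b ⟩ → τS ∋⟨ a , b ⟩ ⊎ (b ≡ y × (a ∈ D ⊎ a ≡ y))
    ∋-R⁻ = ∋-adjoinTop⁻ y D τS

    ∋-R⁺ : ∀ {a b} → τS ∋⟨ a , b ⟩ ⊎ (b ≡ y × (a ∈ D ⊎ a ≡ y)) → R ∋⟨ a , b ⟩
    ∋-R⁺ = ∋-adjoinTop⁺ y D τS

    τS-within-W : ∀ {a b} → τS ∋⟨ a , b ⟩ → a ∈ W × b ∈ W
    τS-within-W {a} {b} = IsPOR.support τS-por a b

    Z∉D : ∀ {a} → a ∈ Z → a ∈ D → ⊥
    Z∉D a∈Z a∈D = proj₂ (x∈p─q⁻ W V a∈D) (Z⊆V a∈Z)

    above-Z-in-V : ∀ {a b} → a ∈ Z → τS ∋⟨ a , b ⟩ → b ∈ V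
    above-Z-in-V {a} {b} a∈Z ab = τ-upperEnd D∩V≡∅ S a b ab (Z⊆V a∈Z)

    y-maximal : ∀ {b} → R ∋⟨ y , b ⟩ → b ≡ y
    y-maximal yb with ∋-R⁻ yb
    ... | inj₁ yb′       = ⊥-elim (y∉W (proj₁ (τS-within-W yb′)))
    ... | inj₂ (b≡y , _) = b≡y

    Z≰y : ∀ {a} → a ∈ Z → ¬ R ∋⟨ a , y ⟩
    Z≰y a∈Z ay with ∋-R⁻ ay
    ... | inj₁ ay′            = y∉W (proj₂ (τS-within-W ay′))
    ... | inj₂ (_ , inj₁ a∈D) = Z∉D a∈Z a∈D
    ... | inj₂ (_ , inj₂ refl) = y∉Z a∈Z

    R-on-Z : ∀ {a b} → a ∈ Z → b ∈ Z → R ∋⟨ a , b ⟩ ⇔ Q ∋⟨ a , b ⟩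
    R-on-Z {a} {b} a∈Z b∈Z =
      mk⇔ to′ (λ ab → ∋-R⁺ (inj₁ (from τS-on-Z (from (S-on-Z b∈Z a∈Z) ab))))
      where
      τS-on-Z : τS ∋⟨ a , b ⟩ ⇔ S ∋⟨ b , a ⟩
      τS-on-Z = τS-on-V (Z⊆V a∈Z) (Z⊆V b∈Z)
      to′ : R ∋⟨ a , b ⟩ → Q ∋⟨ a , b ⟩
      to′ ab with ∋-R⁻ ab
      ... | inj₁ ab′        = to (S-on-Z b∈Z a∈Z) (to τS-on-Z ab′)
      ... | inj₂ (refl , _) = ⊥-elim (y∉Z b∈Z)

    R|Y≡Q⁺ : restrict R Y ≡ Q⁺
    R|Y≡Q⁺ = Rel-ext λ a b → mk⇔ (to′ a b) (from′ a b)
      where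
      to′ : ∀ a b → restrict R Y ∋⟨ a , b ⟩ → Q⁺ ∋⟨ a , b ⟩
      to′ a b t with ∋-restrict⁻ R Y t
      ... | ab , a∈Y , b∈Y with Y-cases a∈Y | Y-cases b∈Y
      ... | inj₁ a∈Z | inj₁ b∈Z = ∋-Q⁺⁺ (inj₁ (to (R-on-Z a∈Z b∈Z) ab))
      ... | inj₁ a∈Z | inj₂ refl = ⊥-elim (Z≰y a∈Z ab)
      ... | inj₂ refl | _        = ∋-Q⁺⁺ (inj₂ (refl , y-maximal ab))
      from′ : ∀ a b → Q⁺ ∋⟨ a , b ⟩ → restrict R Y ∋⟨ a , b ⟩
      from′ a b q with ∋-Q⁺⁻ q
      ... | inj₁ ab = let (a∈Z , b∈Z) = IsPOR.support Q-por a b ab in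
                      ∋-restrict⁺ R Y (from (R-on-Z a∈Z b∈Z) ab , Z⊆Y a∈Z , Z⊆Y b∈Z)
      ... | inj₂ (refl , refl) = ∋-restrict⁺ R Y (∋-R⁺ (inj₂ (refl , inj₂ refl)) , y∈Y , y∈Y)

    Z-convex : Convex S Z
    Z-convex = proj₂ (proj₂ S∈ℭ)

    Y-convex : Convex R Y
    Y-convex a x b ax xb a∈Y b∈Y with ∋-R⁻ ax | ∋-R⁻ xb
    ... | inj₂ (refl , _) | _                      = y∈Y
    ... | inj₁ _         | inj₂ (_ , inj₂ refl)    = y∈Y
    ... | inj₁ ax′       | inj₂ (_ , inj₁ x∈D)     =
      ⊥-elim (D∩V≡∅ (x , x∈p∩q⁺ (x∈D , above-Z-in-V a∈Z ax′)))
      where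
      a∈Z : a ∈ Z
      a∈Z = W∩Y⊆Z (proj₁ (τS-within-W ax′)) a∈Y
    ... | inj₁ ax′       | inj₁ xb′ = Z⊆Y (Z-convex b x a bx xa b∈Z a∈Z)
      where
      a∈Z : a ∈ Z
      a∈Z = W∩Y⊆Z (proj₁ (τS-within-W ax′)) a∈Y
      b∈Z : b ∈ Z
      b∈Z = W∩Y⊆Z (proj₂ (τS-within-W xb′)) b∈Y
      x∈V : x ∈ V
      x∈V = above-Z-in-V a∈Z ax′
      bx : S ∋⟨ b , x ⟩
      bx = to (τS-on-V x∈V (Z⊆V b∈Z)) xb′
      xa : S ∋⟨ x , a ⟩
      xa = to (τS-on-V (Z⊆V a∈Z) x∈V) ax′

    max-agree : ∀ x → IsMax Y Q⁺ x ⇔ IsMax (X ∪ Y) R x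
    max-agree x = mk⇔ to′ from′
      where
      to′ : IsMax Y Q⁺ x → IsMax (X ∪ Y) R x
      to′ (x∈Y , x-max) = q⊆p∪q X Y x∈Y , maximal (Y-cases x∈Y)
        where
        maximal : x ∈ Z ⊎ x ≡ y → ∀ z → R ∋⟨ x , z ⟩ → z ≡ x
        maximal (inj₂ refl) z xz = y-maximal xz
        maximal (inj₁ x∈Z)  z xz with ∋-R⁻ xz
        ... | inj₂ (_ , inj₁ x∈D)  = ⊥-elim (Z∉D x∈Z x∈D)
        ... | inj₂ (_ , inj₂ refl) = ⊥-elim (y∉Z x∈Z)
        ... | inj₁ xz′ with ∈-upClosure⁻ S Z (above-Z-in-V x∈Z xz′)
        ... | w , w∈Z , wz = x-max z (∋-Q⁺⁺ (inj₁ (to (R-on-Z x∈Z z∈Z) xz)))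
          where
          z∈Z : z ∈ Z
          z∈Z = Z-convex w z x wz (to (τS-on-V (Z⊆V x∈Z) (above-Z-in-V x∈Z xz′)) xz′) w∈Z x∈Z

      from′ : IsMax (X ∪ Y) R x → IsMax Y Q⁺ x
      from′ (x∈X∪Y , x-max) = x∈Y (x∈p∪q⁻ X Y x∈X∪Y) , λ z xz → x-max z (Q⁺⊆R x z xz)
        where
        Q⁺⊆R : ∀ a b → Q⁺ ∋⟨ a , b ⟩ → R ∋⟨ a , b ⟩
        Q⁺⊆R a b q = proj₁ (∋-restrict⁻ R Y (subst (_∋⟨ a , b ⟩) (sym R|Y≡Q⁺) q))
        x∈Y : x ∈ X ⊎ x ∈ Y → x ∈ Y
        x∈Y (inj₂ x∈Y) = x∈Y
        x∈Y (inj₁ x∈X) with x ∈? V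
        ... | yes x∈V = let (z , z∈Z , zx) = ∈-upClosure⁻ S Z x∈V
                            z≡x = x-max z (∋-R⁺ (inj₁ (from (τS-on-V x∈V (Z⊆V z∈Z)) zx)))
                        in ⊥-elim (X∩Z=∅ (x , x∈p∩q⁺ (x∈X , subst (_∈ Z) z≡x z∈Z)))
        ... | no  x∉V = let x∈D = x∈p∧x∉q⇒x∈p─q (X⊆W x∈X) x∉V
                            y≡x = x-max y (∋-R⁺ (inj₂ (refl , inj₁ x∈D)))
                        in ⊥-elim (y∉X (subst (_∈ X) (sym y≡x) x∈X))

    σ⁻¹-𝔐* : 𝔐* Q⁺ X Y R
    σ⁻¹-𝔐* = (R-por , R|Y≡Q⁺ , Y-convex) , max-agree

    W∩↓y≡D : W ∩ down R y ≡ D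
    W∩↓y≡D = ⊆-antisym ⊆D D⊆
      where
      ⊆D : W ∩ down R y ⊆ D
      ⊆D a∈ with x∈p∩q⁻ W (down R y) a∈
      ... | a∈W , a∈↓y with to (∈-down-adjoinTop τS-por y∉W D) a∈↓y
      ... | inj₁ a∈D = a∈D
      ... | inj₂ a≡y = ⊥-elim (∈W⇒≢y a∈W a≡y)
      D⊆ : D ⊆ W ∩ down R y
      D⊆ a∈D = x∈p∩q⁺ (p─q⊆p W V a∈D , from (∈-down-adjoinTop τS-por y∉W D) (inj₁ a∈D))

    W─↓y≡V : W ─ down R y ≡ V
    W─↓y≡V = ⊆-antisym ⊆V V⊆
      where
      ⊆V : W ─ down R y ⊆ V
      ⊆V {a} a∈ with x∈p─q⁻ W (down R y) a∈ | a ∈? V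
      ... | _ , _          | yes a∈V = a∈V
      ... | a∈W , a∉↓y     | no  a∉V =
        ⊥-elim (a∉↓y (from (∈-down-adjoinTop τS-por y∉W D) (inj₁ (x∈p∧x∉q⇒x∈p─q a∈W a∉V))))
      V⊆ : V ⊆ W ─ down R y
      V⊆ {a} a∈V = x∈p∧x∉q⇒x∈p─q (V⊆W a∈V) a∉↓y
        where
        a∉↓y : a ∉ down R y
        a∉↓y a∈↓y with to (∈-down-adjoinTop τS-por y∉W D) a∈↓y
        ... | inj₁ a∈D = D∩V≡∅ (a , x∈p∩q⁺ (a∈D , a∈V))
        ... | inj₂ a≡y = ∈W⇒≢y (V⊆W a∈V) a≡y

    σ∘σ⁻¹ : σ W y R ≡ S
    σ∘σ⁻¹ = begin
      τ (W ∩ down R y) (W ─ down R y) (restrict R W)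
        ≡⟨ cong (τ (W ∩ down R y) (W ─ down R y)) (restrict-adjoinTop τS-por y∉W D) ⟩
      τ (W ∩ down R y) (W ─ down R y) τS
        ≡⟨ cong₂ (λ D′ V′ → τ D′ V′ τS) W∩↓y≡D W─↓y≡V ⟩
      τ D V τS
        ≡⟨ τ-involutive D∩V≡∅ S-𝔘 ⟩
      S ∎
      where open ≡-Reasoning

theorem3 : (n : ℕ) (X Z : Subset n) (Q : Rel n) (y : Fin n) →
  Empty (X ∩ Z) → IsPOR Z Q → y ∉ X → y ∉ Z →
  ((R : Rel n) → 𝔐* (Q ∪R diagPoint y) X (Z ∪ ⁅ y ⁆) R →
     𝔘 ((X ∪ Z) ∩ down R y) ((X ∪ Z) ─ down R y) (restrict R (X ∪ Z)))
  × ((R : Rel n) → 𝔐* (Q ∪R diagPoint y) X (Z ∪ ⁅ y ⁆) R →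
     ℭ (dual Q) X Z (σ (X ∪ Z) y R))
  × ((R R′ : Rel n) → 𝔐* (Q ∪R diagPoint y) X (Z ∪ ⁅ y ⁆) R →
     𝔐* (Q ∪R diagPoint y) X (Z ∪ ⁅ y ⁆) R′ →
     σ (X ∪ Z) y R ≡ σ (X ∪ Z) y R′ → R ≡ R′)
  × ((S : Rel n) → ℭ (dual Q) X Z S →
     Σ (Rel n) λ R → 𝔐* (Q ∪R diagPoint y) X (Z ∪ ⁅ y ⁆) R × (σ (X ∪ Z) y R ≡ S))
theorem3 n X Z Q y X∩Z≡∅ Q-por y∉X y∉Z =
    (λ R R∈𝔐* → Forward.P-𝔘 R∈𝔐*)
  , (λ R R∈𝔐* → Forward.σR-ℭ R∈𝔐*)
  , injective
  , (λ S S∈ℭ → σ⁻¹ S , Backward.σ⁻¹-𝔐* S∈ℭ , Backward.σ∘σ⁻¹ S∈ℭ)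
  where
  open Bijection X Z Q y X∩Z≡∅ Q-por y∉X y∉Z
  injective : (R R′ : Rel n) → 𝔐* Q⁺ X Y R → 𝔐* Q⁺ X Y R′ →
              σ W y R ≡ σ W y R′ → R ≡ R′
  injective R R′ R∈𝔐* R′∈𝔐* σR≡σR′ = begin
    R              ≡⟨ Forward.σ⁻¹∘σ R∈𝔐* ⟨
    σ⁻¹ (σ W y R)  ≡⟨ cong σ⁻¹ σR≡σR′ ⟩
    σ⁻¹ (σ W y R′) ≡⟨ Forward.σ⁻¹∘σ R′∈𝔐* ⟩
    R′             ∎
    where open ≡-Reasoning
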